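{- Let $S^{(i)},S^{(j)}\subseteq\mathbb S_O$ be finite knowledge bases and $A^{(i)}=\mathrm{Atom}(S^{(i)})$. Then $\mathsf F_{\mathrm{Cn}}(S^{(i)},S^{(j)})=1$ if and only if $\mathrm{Cn}(S^{(i)})=\mathrm{Cn}(S^{(j)})$, and this holds if and only if both (F1) $A^{(i)}\subseteq\mathrm{Cn}(S^{(j)})$, and (F2) $S^{(j)}\setminus S^{(i)}\subseteq\mathrm{Cn}(S^{(i)})$ are satisfied.
   Context: $\mathbb S_O$ is a countable semantic universe equipped with a deductive closure operator $\mathrm{Cn}$ (from a fixed proof system) satisfying reflexivity $\Gamma\subseteq\mathrm{Cn}(\Gamma)$, monotonicity, and idempotence $\mathrm{Cn}(\mathrm{Cn}(\Gamma))=\mathrm{Cn}(\Gamma)$; closures of finite sets are finite and membership in them is decidable. Knowledge bases are finite subsets listed in a fixed canonical order; $\mathrm{Atom}(S)$ is obtained by scanning $S$ in canonical order from $A=S$ and deleting $s$ from $A$ whenever $s\in\mathrm{Cn}(A\setminus\{s\})$. Closure fidelity: $\mathsf F_{\mathrm{Cn}}(S,\hat S)=|\mathrm{Cn}(S)\cap\mathrm{Cn}(\hat S)|/|\mathrm{Cn}(S)\cup\mathrm{Cn}(\hat S)|$, with $0/0:=1$. -}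

module Defs where

open import Data.Nat using (ℕ; zero; suc; _<_)
import Data.Nat as ℕ
open import Data.Integer using (+_)
open import Data.Rational using (ℚ; _/_; 1ℚ)
open import Data.List using (List; []; _∷_; _++_; filter; length; deduplicate)
open import Data.List.Membership.Propositional using (_∈_; _∉_)
open import Data.List.Relation.Binary.Subset.Propositional using (_⊆_)
open import Data.List.Relation.Unary.Linked using (Linked)
open import Data.List.Relation.Unary.Any using (any?)
open import Data.Product using (_×_)
open import Function using (_∘_)
open import Relation.Nullary using (Dec; yes; no; ¬_; ¬?)
open import Relation.Nullary.Decidable using (map′)
open import Relation.Binary.PropositionalEquality using (_≡_; refl; cong)

-- Sets of sentences are represented by lists (read as finite sets: only
-- membership matters).  A deductive-closure system on a countable universe.
record ClosureSystem : Set₁ where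
  field
    Sent       : Set
    -- countability: an injective encoding into ℕ (also fixes the canonical order)
    enc        : Sent → ℕ
    enc-inj    : ∀ {x y} → enc x ≡ enc y → x ≡ y
    Cn         : List Sent → List Sent
    Cn-refl    : ∀ Γ → Γ ⊆ Cn Γ
    Cn-mono    : ∀ {Γ Δ} → Γ ⊆ Δ → Cn Γ ⊆ Cn Δ
    Cn-idem    : ∀ Γ → (Cn (Cn Γ) ⊆ Cn Γ) × (Cn Γ ⊆ Cn (Cn Γ))

  _≟_ : (x y : Sent) → Dec (x ≡ y)
  x ≟ y = map′ enc-inj (cong enc) (enc x ℕ.≟ enc y)

  _∈?_ : (x : Sent) (Γ : List Sent) → Dec (x ∈ Γ)
  x ∈? Γ = any? (x ≟_) Γ

  _≺_ : Sent → Sent → Set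
  x ≺ y = enc x < enc y

  record KB : Set where
    constructor kb
    field
      elems  : List Sent
      sorted : Linked _≺_ elems
  open KB public

  _≐_ : List Sent → List Sent → Set
  Γ ≐ Δ = (Γ ⊆ Δ) × (Δ ⊆ Γ)

  remove : Sent → List Sent → List Sent
  remove s = filter (λ x → ¬? (x ≟ s))

  atomScan : List Sent → List Sent → List Sent
  atomScan []       A = A
  atomScan (s ∷ ss) A with s ∈? Cn (remove s A)
  ... | yes _ = atomScan ss (remove s A)
  ... | no  _ = atomScan ss A

  Atom : KB → List Sent
  Atom S = atomScan (elems S) (elems S)

  card : List Sent → ℕ
  card Γ = length (deduplicate _≟_ Γ)

  _∩_ : List Sent → List Sent → List Sent
  Γ ∩ Δ = filter (_∈? Δ) Γ

  ratio : ℕ → ℕ → ℚ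
  ratio n zero    = 1ℚ            -- convention 0/0 := 1
  ratio n (suc d) = + n / suc d

  fidelity : KB → KB → ℚ
  fidelity S S' =
    ratio (card (Cn (elems S) ∩ Cn (elems S'))) (card (Cn (elems S) ++ Cn (elems S')))

-- Fidelity 1 means the two finite closures have an intersection as large as their
-- union; by pigeonhole for duplicate-free lists the intersection then contains the
-- union, i.e. the closures coincide.  For the atom criterion, the scan only deletes
-- sentences derivable from what remains, so Cn (Atom S) = Cn S, and Cn is a closure
-- operator: Cn Γ ⊆ Cn Δ as soon as Γ ⊆ Cn Δ.
module Submission where

open import Defs
open import Data.Product using (_×_; _,_; proj₁; proj₂)
open import Data.Sum using ([_,_])
open import Data.Nat using (zero; suc; _*_; _≤_; _<_; z≤n; s≤s)
open import Data.Nat.Properties using (≤-trans; ≤-antisym; <⇒≢; n≤0⇒n≡0; *-identityʳ; *-identityˡ)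
open import Data.Integer using (+_)
import Data.Integer.Properties as ℤ
open import Data.Rational using (1ℚ)
import Data.Rational.Properties as ℚ
open import Data.Rational.Unnormalised using (mkℚᵘ; *≡*)
open import Data.List using (List; []; _∷_; _++_; filter; length; deduplicate)
open import Data.List.Properties using (filter-notAll)
open import Data.List.Membership.Propositional using (_∈_; _∉_)
open import Data.List.Membership.Propositional.Properties
  using (∈-filter⁺; ∈-filter⁻; ∈-deduplicate⁺; ∈-deduplicate⁻; ∈-++⁺ˡ; ∈-++⁺ʳ; ∈-++⁻)
open import Data.List.Relation.Binary.Subset.Propositional using (_⊆_)
open import Data.List.Relation.Unary.Unique.Propositional using (Unique)
open import Data.List.Relation.Unary.Unique.DecPropositional.Properties using (deduplicate-!)
open import Data.List.Relation.Unary.AllPairs using (_∷_)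
open import Data.List.Relation.Unary.All using (lookup)
open import Data.List.Relation.Unary.Any using (here; there)
import Data.List.Relation.Unary.Any as Any
open import Function using (_∘_)
open import Function.Bundles using (_⇔_; mk⇔)
open import Function.Construct.Composition using (_⇔-∘_)
open import Relation.Binary.Definitions using (DecidableEquality)
open import Relation.Binary.PropositionalEquality using (_≡_; refl; sym; module ≡-Reasoning)
open import Relation.Nullary using (yes; no; ¬?; contradiction)

module DuplicateFree {A : Set} (_≟_ : DecidableEquality A) where

  open import Data.List.Membership.DecPropositional _≟_ using (_∈?_)

  private
    without : A → List A → List A
    without y = filter (λ x → ¬? (x ≟ y))

    length-without< : ∀ {y ys} → y ∈ ys → suc (length (without y ys)) ≤ length ys
    length-without< {y} {ys} y∈ys =
      filter-notAll (λ x → ¬? (x ≟ y)) ys (Any.map (λ y≡x x≢y → x≢y (sym y≡x)) y∈ys)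

    ⊆-without : ∀ {xs ys y} → xs ⊆ ys → y ∉ xs → xs ⊆ without y ys
    ⊆-without {y = y} xs⊆ys y∉xs {x} x∈xs =
      ∈-filter⁺ (λ z → ¬? (z ≟ y)) (xs⊆ys x∈xs) (λ { refl → y∉xs x∈xs })

  length-mono-⊆ : ∀ {xs ys} → Unique xs → xs ⊆ ys → length xs ≤ length ys
  length-mono-⊆ {[]}     _                _      = z≤n
  length-mono-⊆ {x ∷ xs} (x≢xs ∷ xs-uniq) x∷xs⊆ys =
    ≤-trans (s≤s (length-mono-⊆ xs-uniq (⊆-without (x∷xs⊆ys ∘ there) x∉xs)))
            (length-without< (x∷xs⊆ys (here refl)))
    where
    x∉xs : x ∉ xs
    x∉xs x∈xs = lookup x≢xs x∈xs refl

  length-<-⊆ : ∀ {xs ys y} → Unique xs → xs ⊆ ys → y ∈ ys → y ∉ xs → length xs < length ys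
  length-<-⊆ xs-uniq xs⊆ys y∈ys y∉xs =
    ≤-trans (s≤s (length-mono-⊆ xs-uniq (⊆-without xs⊆ys y∉xs))) (length-without< y∈ys)

  private
    dedup : List A → List A
    dedup = deduplicate _≟_

    dedup-⊆ : ∀ {xs ys} → xs ⊆ ys → dedup xs ⊆ dedup ys
    dedup-⊆ {xs} xs⊆ys = ∈-deduplicate⁺ _≟_ ∘ xs⊆ys ∘ ∈-deduplicate⁻ _≟_ xs

  card-mono : ∀ {xs ys} → xs ⊆ ys → length (dedup xs) ≤ length (dedup ys)
  card-mono {xs} xs⊆ys = length-mono-⊆ (deduplicate-! _≟_ xs) (dedup-⊆ xs⊆ys)

  card-≡⇒⊇ : ∀ {xs ys} → xs ⊆ ys → length (dedup xs) ≡ length (dedup ys) → ys ⊆ xs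
  card-≡⇒⊇ {xs} {ys} xs⊆ys eq {y} y∈ys with y ∈? dedup xs
  ... | yes y∈ = ∈-deduplicate⁻ _≟_ xs y∈
  ... | no  y∉ = contradiction eq (<⇒≢ (length-<-⊆ (deduplicate-! _≟_ xs) (dedup-⊆ xs⊆ys)
                                                     (∈-deduplicate⁺ _≟_ y∈ys) y∉))

module _ (C : ClosureSystem) where
  open ClosureSystem C
  open DuplicateFree _≟_

  ratio-n-n : ∀ n → ratio n n ≡ 1ℚ
  ratio-n-n zero    = refl
  ratio-n-n (suc d) = ℚ.fromℚᵘ-cong {mkℚᵘ (+ suc d) d} {mkℚᵘ (+ 1) 0} (*≡* (ℤ.*-comm (+ suc d) (+ 1)))

  ratio-suc≡1ℚ⇒≡ : ∀ n d → ratio n (suc d) ≡ 1ℚ → n ≡ suc d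
  ratio-suc≡1ℚ⇒≡ n d eq = begin
    n         ≡⟨ *-identityʳ n ⟨
    n * 1     ≡⟨ ℚ.normalize-injective-≃ n 1 (suc d) 1 eq ⟩
    1 * suc d ≡⟨ *-identityˡ (suc d) ⟩
    suc d     ∎
    where open ≡-Reasoning

  -- The 0/0 convention makes ratio n 0 = 1ℚ for every n, hence the hypothesis n ≤ d.
  ratio≡1ℚ⇔≡ : ∀ {n d} → n ≤ d → (ratio n d ≡ 1ℚ) ⇔ (n ≡ d)
  ratio≡1ℚ⇔≡ {n} {zero}  n≤0 = mk⇔ (λ _ → n≤0⇒n≡0 n≤0) (λ { refl → refl })
  ratio≡1ℚ⇔≡ {n} {suc d} _   = mk⇔ (ratio-suc≡1ℚ⇒≡ n d) (λ { refl → ratio-n-n (suc d) })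

  ∩-⊆-++ : ∀ X Y → X ∩ Y ⊆ X ++ Y
  ∩-⊆-++ X Y z∈X∩Y = ∈-++⁺ˡ (proj₁ (∈-filter⁻ (_∈? Y) {xs = X} z∈X∩Y))

  ++-⊆-∩⇔≐ : ∀ X Y → (X ++ Y ⊆ X ∩ Y) ⇔ (X ≐ Y)
  ++-⊆-∩⇔≐ X Y = mk⇔ to from
    where
    to : X ++ Y ⊆ X ∩ Y → X ≐ Y
    to ++⊆∩ = (λ z∈X → proj₂ (∈-filter⁻ (_∈? Y) {xs = X} (++⊆∩ (∈-++⁺ˡ z∈X))))
            , (λ z∈Y → proj₁ (∈-filter⁻ (_∈? Y) {xs = X} (++⊆∩ (∈-++⁺ʳ X z∈Y))))
    from : X ≐ Y → X ++ Y ⊆ X ∩ Y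
    from (X⊆Y , Y⊆X) z∈X++Y =
      [ (λ z∈X → ∈-filter⁺ (_∈? Y) z∈X (X⊆Y z∈X)) , (λ z∈Y → ∈-filter⁺ (_∈? Y) (Y⊆X z∈Y) z∈Y) ]
        (∈-++⁻ X z∈X++Y)

  card-∩≡card-++⇔≐ : ∀ X Y → (card (X ∩ Y) ≡ card (X ++ Y)) ⇔ (X ≐ Y)
  card-∩≡card-++⇔≐ X Y = ++-⊆-∩⇔≐ X Y ⇔-∘ mk⇔
    (card-≡⇒⊇ (∩-⊆-++ X Y))
    (λ ++⊆∩ → ≤-antisym (card-mono (∩-⊆-++ X Y)) (card-mono ++⊆∩))

  ratio-card-∩-++≡1ℚ⇔≐ : ∀ X Y → (ratio (card (X ∩ Y)) (card (X ++ Y)) ≡ 1ℚ) ⇔ (X ≐ Y)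
  ratio-card-∩-++≡1ℚ⇔≐ X Y = card-∩≡card-++⇔≐ X Y ⇔-∘ ratio≡1ℚ⇔≡ (card-mono (∩-⊆-++ X Y))

  Cn-least : ∀ {Γ Δ} → Γ ⊆ Cn Δ → Cn Γ ⊆ Cn Δ
  Cn-least {Δ = Δ} Γ⊆CnΔ = proj₁ (Cn-idem Δ) ∘ Cn-mono Γ⊆CnΔ

  remove-⊆ : ∀ s A → remove s A ⊆ A
  remove-⊆ s A = proj₁ ∘ ∈-filter⁻ (λ x → ¬? (x ≟ s))

  atomScan-⊆ : ∀ ss A → atomScan ss A ⊆ A
  atomScan-⊆ []       A = λ x∈A → x∈A
  atomScan-⊆ (s ∷ ss) A with s ∈? Cn (remove s A)
  ... | yes _ = remove-⊆ s A ∘ atomScan-⊆ ss (remove s A)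
  ... | no  _ = atomScan-⊆ ss A

  ⊆-Cn-atomScan : ∀ ss A → A ⊆ Cn (atomScan ss A)
  ⊆-Cn-atomScan []       A = Cn-refl A
  ⊆-Cn-atomScan (s ∷ ss) A with s ∈? Cn (remove s A)
  ... | no  _           = ⊆-Cn-atomScan ss A
  ... | yes s∈Cn[A∖s] = A⊆CnR
    where
    A∖s⊆CnR : remove s A ⊆ Cn (atomScan ss (remove s A))
    A∖s⊆CnR = ⊆-Cn-atomScan ss (remove s A)
    A⊆CnR : A ⊆ Cn (atomScan ss (remove s A))
    A⊆CnR {x} x∈A with x ≟ s
    ... | yes refl = Cn-least A∖s⊆CnR s∈Cn[A∖s]
    ... | no  x≢s  = A∖s⊆CnR (∈-filter⁺ (λ y → ¬? (y ≟ s)) x∈A x≢s)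

  Cn-Atom : ∀ S → Cn (Atom S) ≐ Cn (elems S)
  Cn-Atom S = Cn-mono (atomScan-⊆ (elems S) (elems S)) , Cn-least (⊆-Cn-atomScan (elems S) (elems S))

  Cn≐⇔Atom⊆×diff⊆ : ∀ Si Sj → (Cn (elems Si) ≐ Cn (elems Sj))
    ⇔ ((Atom Si ⊆ Cn (elems Sj)) × (∀ x → x ∈ elems Sj → x ∉ elems Si → x ∈ Cn (elems Si)))
  Cn≐⇔Atom⊆×diff⊆ Si Sj = mk⇔ to from
    where
    I = elems Si
    J = elems Sj
    to : Cn I ≐ Cn J → (Atom Si ⊆ Cn J) × (∀ x → x ∈ J → x ∉ I → x ∈ Cn I)
    to (CnI⊆CnJ , CnJ⊆CnI) = CnI⊆CnJ ∘ Cn-refl I ∘ atomScan-⊆ I I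
                           , λ _ x∈J _ → CnJ⊆CnI (Cn-refl J x∈J)
    from : (Atom Si ⊆ Cn J) × (∀ x → x ∈ J → x ∉ I → x ∈ Cn I) → Cn I ≐ Cn J
    from (F1 , F2) = Cn-least F1 ∘ proj₂ (Cn-Atom Si) , Cn-least J⊆CnI
      where
      J⊆CnI : J ⊆ Cn I
      J⊆CnI {x} x∈J with x ∈? I
      ... | yes x∈I = Cn-refl I x∈I
      ... | no  x∉I = F2 x x∈J x∉I

proposition22 : (C : ClosureSystem) → let open ClosureSystem C in
    (Si Sj : KB) →
      ((fidelity Si Sj ≡ 1ℚ) ⇔ (Cn (elems Si) ≐ Cn (elems Sj)))
      × ((Cn (elems Si) ≐ Cn (elems Sj))
          ⇔ ((Atom Si ⊆ Cn (elems Sj))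
             × (∀ x → x ∈ elems Sj → x ∉ elems Si → x ∈ Cn (elems Si))))
proposition22 C Si Sj =
  ratio-card-∩-++≡1ℚ⇔≐ C (Cn (elems Si)) (Cn (elems Sj)) , Cn≐⇔Atom⊆×diff⊆ C Si Sj
  where open ClosureSystem C
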